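{- Let $m\ge 3$ be an integer with $m\ne 5$, and let $n\ge 2$ be an integer. With $E(k),U(k),A(k)$ and $CS(m,n)$ defined as in the context, the following hold: (i) $\{n,n+1,n+2,\dots,2n\}\subseteq CS(m,n)$; (ii) $E(k)=\{(n,n+1,n+2,\dots,n+k-1)\}$ for $k=1,2,\dots,n$; (iii) $U(k)=\emptyset$ (equivalently $A(k)=E(k)$) for $k=1,2,\dots,n$; (iv) $E(n+1)=\{(n,n,n+1,n+2,\dots,2n-1),\ (n,n+1,n+2,\dots,2n-1,2n)\}$.
   Context: Let $P_m(x)=\frac{(m-2)x^2-(m-4)x}{2}$ and $\mathcal{GP}_m=\{P_m(u):u\in\mathbb Z\}$. For $k\ge1$ let $\mathcal N(k)=\{(a_1,\dots,a_k)\in\mathbb N^k: a_1\le\cdots\le a_k\}$ ($\mathbb N$ = positive integers), $\mathcal N=\bigcup_k\mathcal N(k)$, identifying $\mathcal N(1)$ with $\mathbb N$. For $\mathbf a\in\mathcal N(k)$ and $g\in\mathbb N$, $\mathbf a*g\in\mathcal N(k+1)$ is the vector whose entries are those of $\mathbf a$ together with $g$, sorted increasingly. For $\mathbf a=(a_1,\dots,a_k)$ let $R'_{\mathcal{GP}_m}(\mathbf a)=\{a_1s_1+\cdots+a_ks_k:s_i\in\mathcal{GP}_m\}\setminus\{0\}$, and let $\mathcal T(n)$ be the set of integers $\ge n$. Define $\Psi(\mathbf a)=\mathcal T(n)\setminus R'_{\mathcal{GP}_m}(\mathbf a)$, $\psi(\mathbf a)=\min\Psi(\mathbf a)$ if $\Psi(\mathbf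 a)\ne\emptyset$ and $\psi(\mathbf a)=\infty$ otherwise; for $\psi(\mathbf a)<\infty$ let $\mathcal E(\mathbf a)=\{g\in\mathbb Z: n\le g\le\psi(\mathbf a)-n\}\cup\{\psi(\mathbf a)\}$. Recursively: $E(1)=\{(n)\}$; $U(k)=\{\mathbf a\in E(k):\psi(\mathbf a)=\infty\}$; $A(k)=E(k)\setminus U(k)$; $E(k+1)=\bigcup_{\mathbf a\in A(k)}\{\mathbf a*g: g\in\mathcal E(\mathbf a)\}$. There is a positive integer $l$ with $A(l)=\emptyset$; taking $l$ to be the smallest such, define $CS(m,n)=\{n\}\cup\bigcup_{k=1}^{l-1}\{\psi(\mathbf a):\mathbf a\in A(k)\}$. -}

module Defs where

open import Data.Nat using (ℕ; zero; suc; _+_; _≤_; _<_; _≤ᵇ_)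
open import Data.Integer as ℤ using (ℤ; +_)
open import Data.Vec using (Vec; []; _∷_)
open import Data.Vec.Relation.Unary.All using (All)
open import Data.Product using (Σ; ∃; ∃-syntax; _×_)
open import Data.Sum using (_⊎_)
open import Data.Bool using (if_then_else_)
open import Relation.Nullary using (¬_)
open import Relation.Binary.PropositionalEquality using (_≡_; _≢_)

-- s ∈ GP_m  iff  s = P_m(u) for some integer u, where
-- P_m(u) = ((m-2)u² - (m-4)u)/2 ; we state it as 2 s = (m-2)u² - (m-4)u
-- (the right-hand side is always even, so this is exactly s = P_m(u)).
InGP : ℕ → ℤ → Set
InGP m s = ∃[ u ] (+ 2 ℤ.* s ≡ (+ m ℤ.- + 2) ℤ.* u ℤ.* u ℤ.- (+ m ℤ.- + 4) ℤ.* u)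

lin : ∀ {k} → Vec ℕ k → Vec ℤ k → ℤ
lin []       []       = + 0
lin (a ∷ as) (s ∷ ss) = + a ℤ.* s ℤ.+ lin as ss

InR' : ℕ → ∀ {k} → Vec ℕ k → ℤ → Set
InR' m {k} a t = t ≢ + 0 × ∃[ s ] (All (InGP m) s × lin {k} a s ≡ t)

-- Ψ(a) = T(n) \ R'(a); elements of T(n) (integers ≥ n ≥ 2) are coded as naturals
InΨ : ℕ → ℕ → ∀ {k} → Vec ℕ k → ℕ → Set
InΨ m n a t = n ≤ t × ¬ InR' m a (+ t)

IsPsi : ℕ → ℕ → ∀ {k} → Vec ℕ k → ℕ → Set
IsPsi m n a p = InΨ m n a p × (∀ t → InΨ m n a t → p ≤ t)

PsiInfinite : ℕ → ℕ → ∀ {k} → Vec ℕ k → Set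
PsiInfinite m n a = ∀ t → ¬ InΨ m n a t

InCalE : ℕ → ℕ → ℕ → Set
InCalE n p g = (n ≤ g × g + n ≤ p) ⊎ g ≡ p

insert : ∀ {k} → ℕ → Vec ℕ k → Vec ℕ (suc k)
insert g []       = g ∷ []
insert g (x ∷ xs) = if g ≤ᵇ x then g ∷ x ∷ xs else x ∷ insert g xs

data InE (m n : ℕ) : (k : ℕ) → Vec ℕ k → Set where
  base : InE m n 1 (n ∷ [])
  step : ∀ {k} {a : Vec ℕ k} {p g : ℕ} →
         InE m n k a → IsPsi m n a p → InCalE n p g →
         InE m n (suc k) (insert g a)

InU : ℕ → ℕ → (k : ℕ) → Vec ℕ k → Set
InU m n k a = InE m n k a × PsiInfinite m n a

InA : ℕ → ℕ → (k : ℕ) → Vec ℕ k → Set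
InA m n k a = InE m n k a × ∃[ p ] IsPsi m n a p

InCS : ℕ → ℕ → ℕ → Set
InCS m n x = x ≡ n ⊎ ∃[ k ] Σ (Vec ℕ k) (λ a → InE m n k a × IsPsi m n a x)

range : ℕ → (k : ℕ) → Vec ℕ k
range n zero    = []
range n (suc k) = n ∷ range (suc n) k

-- Every value P_m(u) with m ≥ 3, m ≠ 5 is a natural number other than 2: write
-- 2 P_m(u) as an explicit product and check the small cases.  Hence a combination
-- of n, n+1, …, n+k-1 with such coefficients is 0, a single entry, or exceeds 2n
-- (two coefficients 1, or one coefficient ≥ 3).  For k ≤ n this makes n+k the
-- least integer ≥ n that is not represented, so ψ(n, …, n+k-1) = n+k, and the
-- only admissible new entry is n+k, joined for k = n by g = n.  Induction on k
-- describes E(1), …, E(n+1), and the values ψ = n+1, …, 2n fill the window in CS.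
module Submission where

open import Defs
open import Data.Nat using (ℕ; zero; suc; _+_; _*_; _≤_; _<_; z≤n; s≤s; z<s; _≤ᵇ_; _≤?_)
open import Data.Nat.Properties
open import Data.Integer as ℤ using (ℤ; +_; -[1+_]; _-_; -_)
import Data.Integer.Properties as ℤₚ
open import Data.Integer.Tactic.RingSolver using (solve-∀)
open import Data.Vec using (Vec; []; _∷_)
open import Data.Vec.Relation.Unary.All as All using (All; []; _∷_)
open import Data.Product using (∃-syntax; _×_; _,_; proj₁)
open import Data.Sum using (_⊎_; inj₁; inj₂)
open import Data.Bool using (true; false)
open import Data.Unit using (tt)
open import Function using (_∘_)
open import Function.Bundles using (_⇔_; mk⇔)
open import Relation.Nullary using (¬_; contradiction; yes; no)
open import Relation.Binary.PropositionalEquality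

NatNot2 : ℤ → Set
NatNot2 s = ∃[ t ] s ≡ + t × t ≢ 2

twiceP : ℕ → ℤ → ℤ
twiceP m u = (+ m - + 2) ℤ.* u ℤ.* u - (+ m - + 4) ℤ.* u

twice⇒NatNot2 : ∀ {s N} → + 2 ℤ.* s ≡ + N → (∀ {t} → 2 * t ≡ N → t ≢ 2) → NatNot2 s
twice⇒NatNot2 {+ t} eq t≢2 = t , refl , t≢2 (ℤₚ.+-injective (trans (ℤₚ.pos-* 2 t) eq))
twice⇒NatNot2 { -[1+ _ ]} ()

≥6⇒half≢2 : ∀ {t N} → 2 * t ≡ N → 6 ≤ N → t ≢ 2
≥6⇒half≢2 refl 6≤4 refl = <-irrefl refl (≤-trans (n≤1+n 5) 6≤4)

twiceP-0 : ∀ m → twiceP m (+ 0) ≡ + 0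
twiceP-0 m = identity (+ m)
  where
  identity : ∀ M → (M - + 2) ℤ.* + 0 ℤ.* + 0 - (M - + 4) ℤ.* + 0 ≡ + 0
  identity = solve-∀

twiceP-1 : ∀ m → twiceP m (+ 1) ≡ + 2
twiceP-1 m = identity (+ m)
  where
  identity : ∀ M → (M - + 2) ℤ.* + 1 ℤ.* + 1 - (M - + 4) ℤ.* + 1 ≡ + 2
  identity = solve-∀

0∈GP : ∀ m → InGP m (+ 0)
0∈GP m = + 0 , sym (twiceP-0 m)

1∈GP : ∀ m → InGP m (+ 1)
1∈GP m = + 1 , sym (twiceP-1 m)

module _ (c : ℕ) where
  open ≡-Reasoning

  twiceP-pos : ∀ j → twiceP (3 + c) (+ suc j) ≡ + (suc j * (2 + j * suc c))
  twiceP-pos j = begin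
    twiceP (3 + c) (+ suc j)              ≡⟨ identity (+ c) (+ j) ⟩
    + suc j ℤ.* (+ 2 ℤ.+ + j ℤ.* + suc c) ≡⟨ cong (λ x → + suc j ℤ.* (+ 2 ℤ.+ x)) (sym (ℤₚ.pos-* j (suc c))) ⟩
    + suc j ℤ.* + (2 + j * suc c)         ≡⟨ sym (ℤₚ.pos-* (suc j) (2 + j * suc c)) ⟩
    + (suc j * (2 + j * suc c))           ∎
    where
    identity : ∀ C J → (+ 3 ℤ.+ C - + 2) ℤ.* (+ 1 ℤ.+ J) ℤ.* (+ 1 ℤ.+ J) - (+ 3 ℤ.+ C - + 4) ℤ.* (+ 1 ℤ.+ J)
                       ≡ (+ 1 ℤ.+ J) ℤ.* (+ 2 ℤ.+ J ℤ.* (+ 1 ℤ.+ C))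
    identity = solve-∀

  twiceP-minus-one : twiceP (3 + c) (- + 1) ≡ + (2 * c)
  twiceP-minus-one = trans (identity (+ c)) (sym (ℤₚ.pos-* 2 c))
    where
    identity : ∀ C → (+ 3 ℤ.+ C - + 2) ℤ.* - + 1 ℤ.* - + 1 - (+ 3 ℤ.+ C - + 4) ℤ.* - + 1 ≡ + 2 ℤ.* C
    identity = solve-∀

  twiceP-neg : ∀ j → twiceP (3 + c) -[1+ suc j ] ≡ + (suc (suc j) * (suc j + c * (3 + j)))
  twiceP-neg j = begin
    twiceP (3 + c) -[1+ suc j ]                   ≡⟨ identity (+ c) (+ j) ⟩
    + (2 + j) ℤ.* (+ suc j ℤ.+ + c ℤ.* + (3 + j)) ≡⟨ cong (λ x → + (2 + j) ℤ.* (+ suc j ℤ.+ x)) (sym (ℤₚ.pos-* c (3 + j))) ⟩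
    + (2 + j) ℤ.* + (suc j + c * (3 + j))         ≡⟨ sym (ℤₚ.pos-* (2 + j) (suc j + c * (3 + j))) ⟩
    + (suc (suc j) * (suc j + c * (3 + j)))       ∎
    where
    identity : ∀ C J → (+ 3 ℤ.+ C - + 2) ℤ.* - (+ 2 ℤ.+ J) ℤ.* - (+ 2 ℤ.+ J) - (+ 3 ℤ.+ C - + 4) ℤ.* - (+ 2 ℤ.+ J)
                       ≡ (+ 2 ℤ.+ J) ℤ.* (+ 1 ℤ.+ J ℤ.+ C ℤ.* (+ 3 ℤ.+ J))
    identity = solve-∀

half-twiceP-pos≢2 : ∀ c j {t} → 2 * t ≡ suc j * (2 + j * suc c) → t ≢ 2
half-twiceP-pos≢2 c zero    () refl
half-twiceP-pos≢2 c (suc j) eq =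
  ≥6⇒half≢2 eq (*-mono-≤ {2} {2 + j} {3} (s≤s (s≤s z≤n)) (s≤s (s≤s (s≤s z≤n))))

half-twiceP-neg≢2 : ∀ c j {t} → 2 * t ≡ suc (suc j) * (suc j + c * (3 + j)) → t ≢ 2
half-twiceP-neg≢2 zero    zero    () refl
half-twiceP-neg≢2 (suc c) zero    eq =
  ≥6⇒half≢2 eq (*-mono-≤ {2} {2} {3} {4 + c * 3} (s≤s (s≤s z≤n)) (s≤s (s≤s (s≤s z≤n))))
half-twiceP-neg≢2 c       (suc j) eq =
  ≥6⇒half≢2 eq (*-mono-≤ {3} {3 + j} {2} (s≤s (s≤s (s≤s z≤n))) (s≤s (s≤s z≤n)))

gp⊆ℕ∖2 : ∀ {m s} → 3 ≤ m → m ≢ 5 → InGP m s → NatNot2 s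
gp⊆ℕ∖2 {suc (suc (suc c))} (s≤s (s≤s (s≤s _))) _   (+ zero , eq) =
  twice⇒NatNot2 (trans eq (twiceP-0 (3 + c))) λ { () refl }
gp⊆ℕ∖2 {suc (suc (suc c))} (s≤s (s≤s (s≤s _))) _   (+ suc j , eq) =
  twice⇒NatNot2 (trans eq (twiceP-pos c j)) (half-twiceP-pos≢2 c j)
gp⊆ℕ∖2 {suc (suc (suc c))} (s≤s (s≤s (s≤s _))) m≢5 (-[1+ zero ] , eq) =
  -- P_m(-1) = m - 3, which is 2 exactly for m = 5
  twice⇒NatNot2 (trans eq (twiceP-minus-one c))
    λ {t} 2t≡2c → m≢5 ∘ cong (λ z → 3 + z) ∘ trans (sym (*-cancelˡ-≡ t c 2 2t≡2c))
gp⊆ℕ∖2 {suc (suc (suc c))} (s≤s (s≤s (s≤s _))) _   (-[1+ suc j ] , eq) =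
  twice⇒NatNot2 (trans eq (twiceP-neg c j)) (half-twiceP-neg≢2 c j)

insert-≤ : ∀ {k g x} (xs : Vec ℕ k) → g ≤ x → insert g (x ∷ xs) ≡ g ∷ x ∷ xs
insert-≤ {g = g} {x} xs g≤x with g ≤ᵇ x | ≤⇒≤ᵇ g≤x
... | true | _ = refl

insert-> : ∀ {k g x} (xs : Vec ℕ k) → x < g → insert g (x ∷ xs) ≡ x ∷ insert g xs
insert-> {g = g} {x} xs x<g with g ≤ᵇ x | ≤ᵇ⇒≤ g x
... | true  | g≤x = contradiction (g≤x tt) (<⇒≱ x<g)
... | false | _   = refl

insert-head-range : ∀ n k → insert n (range n k) ≡ n ∷ range n k
insert-head-range n zero    = refl
insert-head-range n (suc k) = insert-≤ (range (suc n) k) ≤-refl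

insert-last-range : ∀ n k → insert (n + k) (range n k) ≡ range n (suc k)
insert-last-range n zero    = cong (_∷ []) (+-identityʳ n)
insert-last-range n (suc k) = begin
  insert (n + suc k) (n ∷ range (suc n) k) ≡⟨ insert-> (range (suc n) k) (m<m+n n z<s) ⟩
  n ∷ insert (n + suc k) (range (suc n) k) ≡⟨ cong (λ g → n ∷ insert g (range (suc n) k)) (+-suc n k) ⟩
  n ∷ insert (suc n + k) (range (suc n) k) ≡⟨ cong (n ∷_) (insert-last-range (suc n) k) ⟩
  range n (suc (suc k))                    ∎
  where open ≡-Reasoning

data RangeSum (n k : ℕ) : ℕ → Set where
  none   : RangeSum n k 0
  entry  : ∀ {t} → n ≤ t → t < n + k → RangeSum n k t
  beyond : ∀ {t} → n + n < t → RangeSum n k t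

RangeSum-widen : ∀ {n k t} → RangeSum (suc n) k t → RangeSum n (suc k) t
RangeSum-widen none = none
RangeSum-widen {n} {k} {t} (entry n<t t<1+n+k) = entry (<⇒≤ n<t) (subst (t <_) (sym (+-suc n k)) t<1+n+k)
RangeSum-widen {n} (beyond 2+2n<t) = beyond (<-trans (+-mono-< (n<1+n n) (n<1+n n)) 2+2n<t)

n+n<n*[3+x] : ∀ {n} x → 0 < n → n + n < n * (3 + x)
n+n<n*[3+x] {n} x n>0 = begin-strict
  n + n             <⟨ +-monoʳ-< n (m<m+n n n>0) ⟩
  n + (n + n)       ≡⟨ cong (λ z → n + (n + z)) (sym (+-identityʳ n)) ⟩
  3 * n             ≡⟨ *-comm 3 n ⟩
  n * 3             ≤⟨ *-monoʳ-≤ n (m≤m+n 3 x) ⟩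
  n * (3 + x)       ∎
  where open ≤-Reasoning

RangeSum-cons : ∀ {n k t} s → 0 < n → s ≢ 2 → RangeSum (suc n) k t → RangeSum n (suc k) (n * s + t)
RangeSum-cons {n} zero _ _ rs rewrite *-zeroʳ n = RangeSum-widen rs
RangeSum-cons {n} 1 _ _ rs rewrite *-identityʳ n = add-entry rs
  where
  add-entry : ∀ {k t} → RangeSum (suc n) k t → RangeSum n (suc k) (n + t)
  add-entry none = entry (m≤m+n n 0) (+-monoʳ-< n z<s)
  add-entry (entry n<t _) = beyond (+-monoʳ-< n n<t)
  add-entry {t = t} (beyond 2+2n<t) =
    beyond (<-≤-trans (<-trans (+-mono-< (n<1+n n) (n<1+n n)) 2+2n<t) (m≤n+m t n))
RangeSum-cons 2 _ 2≢2 _ = contradiction refl 2≢2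
RangeSum-cons {n} {t = t} (suc (suc (suc x))) n>0 _ _ = beyond (<-≤-trans (n+n<n*[3+x] x n>0) (m≤m+n _ t))

lin-range∈RangeSum : ∀ {n} k (s : Vec ℤ k) → 0 < n → All NatNot2 s → ∃[ t ] lin (range n k) s ≡ + t × RangeSum n k t
lin-range∈RangeSum zero [] _ [] = 0 , refl , none
lin-range∈RangeSum {n} (suc k) (_ ∷ s) n>0 ((t₀ , refl , t₀≢2) ∷ ns) =
  let t , eq , rs = lin-range∈RangeSum k s z<s ns
  in n * t₀ + t , cong₂ ℤ._+_ (sym (ℤₚ.pos-* n t₀)) eq , RangeSum-cons t₀ n>0 t₀≢2 rs

RangeSum-gap : ∀ {n k t} → 0 < n → k ≤ n → RangeSum n k t → t ≢ n + k
RangeSum-gap n>0 _     none              0≡n+k = <⇒≢ (<-≤-trans n>0 (m≤m+n _ _)) 0≡n+k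
RangeSum-gap _   _     (entry _ t<n+k)   refl  = <-irrefl refl t<n+k
RangeSum-gap {n} _ k≤n (beyond n+n<t)    refl  = <⇒≱ n+n<t (+-monoʳ-≤ n k≤n)

InSpan : ℕ → ∀ {k} → Vec ℕ k → ℤ → Set
InSpan m {k} a t = ∃[ s ] All (InGP m) s × lin {k} a s ≡ t

span-∷ : ∀ m {k x t} {a : Vec ℕ k} → InSpan m a t → InSpan m (x ∷ a) t
span-∷ m {x = x} {t} (s , gp , eq) =
  + 0 ∷ s , 0∈GP m ∷ gp , trans (cong₂ ℤ._+_ (ℤₚ.*-zeroʳ (+ x)) eq) (ℤₚ.+-identityˡ t)

span-0 : ∀ m {k} (a : Vec ℕ k) → InSpan m a (+ 0)
span-0 m []      = [] , [] , refl
span-0 m (x ∷ a) = span-∷ m (span-0 m a)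

span-head : ∀ m {k} x (a : Vec ℕ k) → InSpan m (x ∷ a) (+ x)
span-head m x a =
  let s , gp , eq = span-0 m a
  in + 1 ∷ s , 1∈GP m ∷ gp , trans (cong₂ ℤ._+_ (ℤₚ.*-identityʳ (+ x)) eq) (ℤₚ.+-identityʳ (+ x))

span-range : ∀ m n {k i} → i < k → InSpan m (range n k) (+ (n + i))
span-range m n {suc k} {zero}  _ =
  subst (InSpan m (range n (suc k)) ∘ +_) (sym (+-identityʳ n)) (span-head m n (range (suc n) k))
span-range m n {suc k} {suc i} (s≤s i<k) =
  subst (InSpan m (range n (suc k)) ∘ +_) (sym (+-suc n i)) (span-∷ m (span-range m (suc n) i<k))

IsPsi-unique : ∀ {m n k} {a : Vec ℕ k} {p q} → IsPsi m n a p → IsPsi m n a q → p ≡ q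
IsPsi-unique (p∈Ψ , p-min) (q∈Ψ , q-min) = ≤-antisym (p-min _ q∈Ψ) (q-min _ p∈Ψ)

module EarlyLevels {m n : ℕ} (gp⊆ℕ∖2 : ∀ {s} → InGP m s → NatNot2 s) (n>0 : 0 < n) where

  range-gap : ∀ {k} → k ≤ n → ¬ InR' m (range n k) (+ (n + k))
  range-gap {k} k≤n (_ , s , gp , eq) =
    let t , eq′ , rs = lin-range∈RangeSum k s n>0 (All.map gp⊆ℕ∖2 gp)
    in RangeSum-gap n>0 k≤n rs (ℤₚ.+-injective (trans (sym eq′) eq))

  ψ-range : ∀ {k} → k ≤ n → IsPsi m n (range n k) (n + k)
  ψ-range {k} k≤n = (m≤m+n n k , range-gap k≤n) , minimal
    where
    minimal : ∀ t → InΨ m n (range n k) t → n + k ≤ t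
    minimal t (n≤t , t∉R) with n + k ≤? t
    ... | yes n+k≤t = n+k≤t
    ... | no  n+k≰t with i , refl ← m≤n⇒∃[o]m+o≡n n≤t =
      contradiction (n+i≢0 , span-range m n (+-cancelˡ-< n i k (≰⇒> n+k≰t))) t∉R
      where
      n+i≢0 : + (n + i) ≢ + 0
      n+i≢0 = <⇒≢ (<-≤-trans n>0 (m≤m+n n i)) ∘ sym ∘ ℤₚ.+-injective

  ψ-range-unique : ∀ {k p} → k ≤ n → IsPsi m n (range n k) p → p ≡ n + k
  ψ-range-unique {k} k≤n ψ = IsPsi-unique {m} {a = range n k} ψ (ψ-range k≤n)

  E-range : ∀ {k a} → InE m n k a → k ≤ n → a ≡ range n k
  E-range base _ = refl
  E-range (step {k} e ψ g∈ℰ) k<n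
    with refl ← E-range e (<⇒≤ k<n)
    with refl ← ψ-range-unique (<⇒≤ k<n) ψ = last g∈ℰ
    where
    last : ∀ {g} → InCalE n (n + k) g → insert g (range n k) ≡ range n (suc k)
    last (inj₁ (n≤g , g+n≤n+k)) = contradiction (+-cancelˡ-≤ n n k (≤-trans (+-monoˡ-≤ n n≤g) g+n≤n+k)) (<⇒≱ k<n)
    last (inj₂ refl)            = insert-last-range n k

  range-E : ∀ {k} → 0 < k → k ≤ n → InE m n k (range n k)
  range-E {suc zero}    _ _       = base
  range-E {suc (suc k)} _ 2+k≤n = subst (InE m n (suc (suc k))) (insert-last-range n (suc k))
    (step (range-E z<s (<⇒≤ 2+k≤n)) (ψ-range (<⇒≤ 2+k≤n)) (inj₂ refl))

  E-next : ∀ {a} → InE m n (suc n) a ⇔ (a ≡ n ∷ range n n ⊎ a ≡ range n (suc n))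
  E-next = mk⇔ to from
    where
    next : ∀ {g} → InCalE n (n + n) g → insert g (range n n) ≡ n ∷ range n n ⊎ insert g (range n n) ≡ range n (suc n)
    next (inj₁ (n≤g , g+n≤n+n)) with refl ← ≤-antisym (+-cancelʳ-≤ n _ n g+n≤n+n) n≤g = inj₁ (insert-head-range n n)
    next (inj₂ refl)                                                                  = inj₂ (insert-last-range n n)

    to : ∀ {a} → InE m n (suc n) a → a ≡ n ∷ range n n ⊎ a ≡ range n (suc n)
    to base = contradiction n>0 (<-irrefl refl)
    to (step e ψ g∈ℰ)
      with refl ← E-range e ≤-refl
      with refl ← ψ-range-unique ≤-refl ψ = next g∈ℰ

    extend : ∀ {g} → InCalE n (n + n) g → InE m n (suc n) (insert g (range n n))
    extend = step (range-E n>0 ≤-refl) (ψ-range ≤-refl)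

    from : ∀ {a} → a ≡ n ∷ range n n ⊎ a ≡ range n (suc n) → InE m n (suc n) a
    from (inj₁ refl) = subst (InE m n (suc n)) (insert-head-range n n) (extend (inj₁ (≤-refl , ≤-refl)))
    from (inj₂ refl) = subst (InE m n (suc n)) (insert-last-range n n) (extend (inj₂ refl))

  ψ-E : ∀ {k a} → InE m n k a → k ≤ n → IsPsi m n a (n + k)
  ψ-E e k≤n with refl ← E-range e k≤n = ψ-range k≤n

  range-CS : ∀ {k} → k ≤ n → InCS m n (n + k)
  range-CS {zero}  _   = inj₁ (+-identityʳ n)
  range-CS {suc k} k≤n = inj₂ (suc k , range n (suc k) , range-E z<s k≤n , ψ-range k≤n)

  window-CS : ∀ {j} → n ≤ j → j ≤ 2 * n → InCS m n j
  window-CS n≤j j≤2n with i , refl ← m≤n⇒∃[o]m+o≡n n≤j =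
    range-CS (+-cancelˡ-≤ n i n (subst (n + i ≤_) (cong (λ z → n + z) (+-identityʳ n)) j≤2n))

proposition3p5 : ∀ (m n : ℕ) → 3 ≤ m → m ≢ 5 → 2 ≤ n →
    (∀ j → n ≤ j → j ≤ 2 * n → InCS m n j)
    × (∀ k → 1 ≤ k → k ≤ n → ∀ (a : Vec ℕ k) → InE m n k a ⇔ (a ≡ range n k))
    × (∀ k → 1 ≤ k → k ≤ n →
         (∀ (a : Vec ℕ k) → ¬ InU m n k a)
         × (∀ (a : Vec ℕ k) → InE m n k a → InA m n k a))
    × (∀ (a : Vec ℕ (suc n)) →
         InE m n (suc n) a ⇔ (a ≡ n ∷ range n n ⊎ a ≡ range n (suc n)))
proposition3p5 m n 3≤m m≢5 2≤n =
    (λ _ → window-CS)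
  , (λ _ k≥1 k≤n _ → mk⇔ (λ e → E-range e k≤n) λ { refl → range-E k≥1 k≤n })
  , (λ k _ k≤n → (λ _ (e , ψ=∞) → ψ=∞ (n + k) (proj₁ (ψ-E e k≤n)))
               , (λ _ e → e , n + k , ψ-E e k≤n))
  , (λ _ → E-next)
  where open EarlyLevels {m} {n} (gp⊆ℕ∖2 3≤m m≢5) (<-≤-trans z<s 2≤n)
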